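{- For all integers $m,n\ge 4$, $\gamma_{oiR}(P_{n}\Box C_{m})\le \frac{5mn+5n+2m}{8}$.
   Context: All graphs are simple and undirected. $P_n$ denotes the path on $n$ vertices and $C_m$ the cycle on $m$ vertices; $P_n\Box C_m$ is their Cartesian product, with vertex set $\{v_{i,j}: 0\le i\le n-1,\ 0\le j\le m-1\}$, where $v_{i,j}$ and $v_{i',j'}$ are adjacent iff either $i=i'$ and $j'\equiv j\pm1 \pmod m$, or $j=j'$ and $|i-i'|=1$. For a graph $G=(V,E)$, an outer independent Roman dominating function (OIRDF) is a function $f:V\to\{0,1,2\}$ such that every vertex $u$ with $f(u)=0$ has a neighbour $v$ with $f(v)=2$, and the set $V_0=\{u\in V: f(u)=0\}$ is an independent set. The weight of $f$ is $w(f)=\sum_{v\in V}f(v)$, and $\gamma_{oiR}(G)$ is the minimum weight of an OIRDF of $G$. -}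

module Defs where

open import Data.Nat using (ℕ; zero; suc; _+_; _*_; _%_; _≤_; NonZero)
open import Data.Fin using (Fin; toℕ)
open import Data.Fin.Patterns using (0F; 1F; 2F)
open import Data.Product using (_×_; _,_; Σ; ∃)
open import Data.Sum using (_⊎_)
open import Relation.Binary.PropositionalEquality using (_≡_)
open import Relation.Nullary using (¬_)
open import Data.List using (List; map; allFin; cartesianProduct)
open import Data.Nat.ListAction using (sum)

Vertex : ℕ → ℕ → Set
Vertex n m = Fin n × Fin m

CycAdj : (m : ℕ) .{{_ : NonZero m}} → Fin m → Fin m → Set
CycAdj m j j' = (toℕ j' ≡ (toℕ j + 1) % m) ⊎ (toℕ j ≡ (toℕ j' + 1) % m)

PathAdj : (n : ℕ) → Fin n → Fin n → Set
PathAdj n i i' = (toℕ i' ≡ suc (toℕ i)) ⊎ (toℕ i ≡ suc (toℕ i'))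

Adj : (n m : ℕ) .{{_ : NonZero m}} → Vertex n m → Vertex n m → Set
Adj n m (i , j) (i' , j') =
  (i ≡ i' × CycAdj m j j') ⊎ (j ≡ j' × PathAdj n i i')

Labelling : ℕ → ℕ → Set
Labelling n m = Vertex n m → Fin 3

record IsOIRDF (n m : ℕ) .{{_ : NonZero m}} (f : Labelling n m) : Set where
  field
    dominated   : ∀ u → f u ≡ 0F → Σ (Vertex n m) λ v → Adj n m u v × f v ≡ 2F
    independent : ∀ u v → f u ≡ 0F → f v ≡ 0F → ¬ Adj n m u v

weight : (n m : ℕ) → Labelling n m → ℕ
weight n m f = sum (map (λ v → toℕ (f v)) (cartesianProduct (allFin n) (allFin m)))

-- γ_oiR(P_n □ C_m) ≤ b  iff  some OIRDF has weight ≤ b.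
-- Since the bound in the theorem is rational, we state
-- "γ_oiR ≤ b / d" as "some OIRDF f has d · w(f) ≤ b".
γoiR≤ : (n m : ℕ) .{{_ : NonZero m}} → (b d : ℕ) → Set
γoiR≤ n m b d = Σ (Labelling n m) λ f → IsOIRDF n m f × d * weight n m f ≤ b

module Submission where

-- Label v_{i,j} by a tile of period 4 in both directions (weight 10 per 4 × 4 block),
-- raised at a few cells of the last row and column.  Its zeros lie on one colour class
-- of the chessboard colouring by i + j, so V₀ is independent: the only edge joining two
-- cells of the same colour is the wrap-around edge of an odd cycle, and the zeros of the
-- last column sit in rows of the other parity than those of column 0.  Every zero is
-- next to one of the two 2s of the tile, or, in column 0, to the last column, which is
-- all 2 in the rows concerned.  For m = 4q + r and n = 4k + s the weight is
-- 10qk + qB + kC + D with B, C, D depending only on r, s ∈ {4,…,7}, so the bound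
-- follows coefficientwise from sixteen evaluated cases.

open import Defs
open import Data.Bool using (Bool; true; false; not; T)
open import Data.Bool.Properties using (not-¬; T-≡)
open import Data.Empty using (⊥)
open import Data.Fin using (Fin; toℕ; fromℕ<)
open import Data.Fin.Patterns using (0F; 1F; 2F; 3F)
open import Data.Fin.Properties using (toℕ<n; toℕ-fromℕ<; toℕ-injective)
open import Data.List using ([]; _∷_; _++_; map; tabulate; applyUpTo; allFin; cartesianProduct)
open import Data.List.Properties using (map-++; map-∘; map-cong; map-tabulate)
open import Data.Nat using (ℕ; zero; suc; _+_; _*_; _%_; _≤_; _<_; _≡ᵇ_; _≤ᵇ_; NonZero; z≤n; s≤s)
open import Data.Nat.DivMod using (n%n≡0; m<n⇒m%n≡m)
open import Data.Nat.ListAction using (sum)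
open import Data.Nat.ListAction.Properties using (sum-++)
open import Data.Nat.Properties
open import Data.Nat.Tactic.RingSolver using (solve-∀)
open import Data.Product using (Σ; ∃₂; _×_; _,_)
open import Data.Product.Properties using (,-injective)
open import Data.Sum using (_⊎_; inj₁; inj₂; swap)
open import Function using (_∘_; id)
open import Function.Bundles using (Equivalence)
open import Relation.Binary.PropositionalEquality
open import Relation.Nullary using (¬_; contradiction)

-- Edges of P_n □ C_m in ℕ-coordinates

[m+1]%n≡1+m : ∀ {m n} .{{_ : NonZero n}} → suc m < n → (m + 1) % n ≡ suc m
[m+1]%n≡1+m {m} {n} 1+m<n = trans (cong (_% n) (+-comm m 1)) (m<n⇒m%n≡m 1+m<n)

[m+1]%n≡0 : ∀ {m n} .{{_ : NonZero n}} → suc m ≡ n → (m + 1) % n ≡ 0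
[m+1]%n≡0 {m} {n} 1+m≡n = trans (cong (_% n) (trans (+-comm m 1) 1+m≡n)) (n%n≡0 n)

data Step (m : ℕ) : ℕ × ℕ → ℕ × ℕ → Set where
  right : ∀ {i j} → Step m (i , j) (i , suc j)
  wrap  : ∀ {i j} → suc j ≡ m → Step m (i , j) (i , 0)
  down  : ∀ {i j} → Step m (i , j) (suc i , j)

InGrid : ℕ → ℕ → ℕ × ℕ → Set
InGrid n m (i , j) = i < n × j < m

coords : ∀ {n m} → Vertex n m → ℕ × ℕ
coords (i , j) = toℕ i , toℕ j

Defended : (n m : ℕ) → (ℕ × ℕ → Fin 3) → ℕ × ℕ → Set
Defended n m φ p = Σ (ℕ × ℕ) λ q → InGrid n m q × (Step m p q ⊎ Step m q p) × φ q ≡ 2F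

module _ {n m : ℕ} .{{_ : NonZero m}} where

  cycAdj⇒step : ∀ {i} (j j' : Fin m) → toℕ j' ≡ (toℕ j + 1) % m → Step m (i , toℕ j) (i , toℕ j')
  cycAdj⇒step {i} j j' e with m≤n⇒m<n∨m≡n (toℕ<n j)
  ... | inj₁ 1+j<m = subst (Step m (i , toℕ j) ∘ (i ,_)) (sym (trans e ([m+1]%n≡1+m 1+j<m))) right
  ... | inj₂ 1+j≡m = subst (Step m (i , toℕ j) ∘ (i ,_)) (sym (trans e ([m+1]%n≡0 1+j≡m))) (wrap 1+j≡m)

  adj⇒step : (u v : Vertex n m) → Adj n m u v → Step m (coords u) (coords v) ⊎ Step m (coords v) (coords u)
  adj⇒step (i , j) (_ , j') (inj₁ (refl , inj₁ e)) = inj₁ (cycAdj⇒step j j' e)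
  adj⇒step (i , j) (_ , j') (inj₁ (refl , inj₂ e)) = inj₂ (cycAdj⇒step j' j e)
  adj⇒step (i , j) (i' , _) (inj₂ (refl , inj₁ e)) = inj₁ (subst (λ k → Step m _ (k , toℕ j)) (sym e) down)
  adj⇒step (i , j) (i' , _) (inj₂ (refl , inj₂ e)) = inj₂ (subst (λ k → Step m _ (k , toℕ j)) (sym e) down)

  step⇒adj : ∀ {p q} (u v : Vertex n m) → coords u ≡ p → coords v ≡ q → Step m p q → Adj n m u v
  step⇒adj (i , j) (i' , j') refl v≡q right =
    let i'≡i , j'≡1+j = ,-injective v≡q
        1+j<m = subst (_< m) j'≡1+j (toℕ<n j')
    in inj₁ (toℕ-injective (sym i'≡i) , inj₁ (trans j'≡1+j (sym ([m+1]%n≡1+m 1+j<m))))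
  step⇒adj (i , j) (i' , j') refl v≡q (wrap 1+j≡m) =
    let i'≡i , j'≡0 = ,-injective v≡q
    in inj₁ (toℕ-injective (sym i'≡i) , inj₁ (trans j'≡0 (sym ([m+1]%n≡0 1+j≡m))))
  step⇒adj (i , j) (i' , j') refl v≡q down =
    let i'≡1+i , j'≡j = ,-injective v≡q
    in inj₂ (toℕ-injective (sym j'≡j) , inj₁ i'≡1+i)

  Adj-sym : ∀ {u v} → Adj n m u v → Adj n m v u
  Adj-sym (inj₁ (i≡i' , e)) = inj₁ (sym i≡i' , swap e)
  Adj-sym (inj₂ (j≡j' , e)) = inj₂ (sym j≡j' , swap e)

  coords-inGrid : (u : Vertex n m) → InGrid n m (coords u)
  coords-inGrid (i , j) = toℕ<n i , toℕ<n j

  vertexAt : ∀ {q} → InGrid n m q → Σ (Vertex n m) λ v → coords v ≡ q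
  vertexAt (i<n , j<m) = (fromℕ< i<n , fromℕ< j<m) , cong₂ _,_ (toℕ-fromℕ< i<n) (toℕ-fromℕ< j<m)

  grid-isOIRDF : (φ : ℕ × ℕ → Fin 3) →
    (∀ {p q} → Step m p q → φ p ≡ 0F → φ q ≡ 0F → ⊥) →
    (∀ {p} → InGrid n m p → φ p ≡ 0F → Defended n m φ p) →
    IsOIRDF n m (φ ∘ coords)
  grid-isOIRDF φ no-zero-step defended = record { dominated = dominated ; independent = independent }
    where
    dominated : ∀ u → φ (coords u) ≡ 0F → Σ (Vertex n m) λ v → Adj n m u v × φ (coords v) ≡ 2F
    dominated u z with defended (coords-inGrid u) z
    ... | q , q∈ , step , φq≡2 with vertexAt q∈
    ... | v , v≡q = v , adj step , subst (λ r → φ r ≡ 2F) (sym v≡q) φq≡2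
      where
      adj : Step m (coords u) q ⊎ Step m q (coords u) → Adj n m u v
      adj (inj₁ s) = step⇒adj u v refl v≡q s
      adj (inj₂ s) = Adj-sym (step⇒adj v u v≡q refl s)

    independent : ∀ u v → φ (coords u) ≡ 0F → φ (coords v) ≡ 0F → ¬ Adj n m u v
    independent u v zu zv uv with adj⇒step u v uv
    ... | inj₁ s = no-zero-step s zu zv
    ... | inj₂ s = no-zero-step s zv zu

tabulate-toℕ : ∀ {A : Set} (f : ℕ → A) k → tabulate (f ∘ toℕ {k}) ≡ applyUpTo f k
tabulate-toℕ f zero    = refl
tabulate-toℕ f (suc k) = cong (f 0 ∷_) (tabulate-toℕ (f ∘ suc) k)

map-allFin : ∀ {A : Set} (f : ℕ → A) k → map (f ∘ toℕ) (allFin k) ≡ applyUpTo f k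
map-allFin f k = trans (map-tabulate id (f ∘ toℕ)) (tabulate-toℕ f k)

sum-cartesianProduct : ∀ {A B : Set} (h : A × B → ℕ) xs ys →
  sum (map h (cartesianProduct xs ys)) ≡ sum (map (λ x → sum (map (λ y → h (x , y)) ys)) xs)
sum-cartesianProduct h []       ys = refl
sum-cartesianProduct h (x ∷ xs) ys = begin
  sum (map h (map (x ,_) ys ++ cartesianProduct xs ys))
    ≡⟨ cong sum (map-++ h (map (x ,_) ys) (cartesianProduct xs ys)) ⟩
  sum (map h (map (x ,_) ys) ++ map h (cartesianProduct xs ys))
    ≡⟨ sum-++ (map h (map (x ,_) ys)) (map h (cartesianProduct xs ys)) ⟩
  sum (map h (map (x ,_) ys)) + sum (map h (cartesianProduct xs ys))
    ≡⟨ cong₂ _+_ (cong sum (sym (map-∘ ys))) (sum-cartesianProduct h xs ys) ⟩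
  sum (map (λ y → h (x , y)) ys) + sum (map (λ x → sum (map (λ y → h (x , y)) ys)) xs)
    ∎
  where open ≡-Reasoning

weight-grid : ∀ {n m} (φ : ℕ × ℕ → Fin 3) →
  weight n m (φ ∘ coords) ≡ sum (applyUpTo (λ i → sum (applyUpTo (λ j → toℕ (φ (i , j))) m)) n)
weight-grid {n} {m} φ = begin
  weight n m (φ ∘ coords)
    ≡⟨ sum-cartesianProduct (toℕ ∘ φ ∘ coords) (allFin n) (allFin m) ⟩
  sum (map (λ i → sum (map (λ j → toℕ (φ (toℕ i , toℕ j))) (allFin m))) (allFin n))
    ≡⟨ cong sum (map-cong (λ i → cong sum (map-allFin (λ j → toℕ (φ (toℕ i , j))) m)) (allFin n)) ⟩
  sum (map (λ i → sum (applyUpTo (λ j → toℕ (φ (toℕ i , j))) m)) (allFin n))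
    ≡⟨ cong sum (map-allFin (λ i → sum (applyUpTo (λ j → toℕ (φ (i , j))) m)) n) ⟩
  sum (applyUpTo (λ i → sum (applyUpTo (λ j → toℕ (φ (i , j))) m)) n)
    ∎
  where open ≡-Reasoning

sum-applyUpTo-cong : ∀ {f g : ℕ → ℕ} → (∀ j → f j ≡ g j) → ∀ k →
  sum (applyUpTo f k) ≡ sum (applyUpTo g k)
sum-applyUpTo-cong f≗g zero    = refl
sum-applyUpTo-cong f≗g (suc k) = cong₂ _+_ (f≗g 0) (sum-applyUpTo-cong (f≗g ∘ suc) k)

sum-applyUpTo-linear : ∀ q (f g : ℕ → ℕ) k →
  sum (applyUpTo (λ j → q * f j + g j) k) ≡ q * sum (applyUpTo f k) + sum (applyUpTo g k)
sum-applyUpTo-linear q f g zero    = sym (trans (+-identityʳ (q * 0)) (*-zeroʳ q))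
sum-applyUpTo-linear q f g (suc k) =
  trans (cong (q * f 0 + g 0 +_) (sum-applyUpTo-linear q (f ∘ suc) (g ∘ suc) k))
        (interchange q (f 0) (g 0) (sum (applyUpTo (f ∘ suc) k)) (sum (applyUpTo (g ∘ suc) k)))
  where
  interchange : ∀ q a b A B → (q * a + b) + (q * A + B) ≡ q * (a + A) + (b + B)
  interchange = solve-∀

sumFlaggingLast : (ℕ → Bool → ℕ) → ℕ → ℕ
sumFlaggingLast h k = sum (applyUpTo (λ j → h j (suc j ≡ᵇ k)) k)

sumFlaggingLast-+ : ∀ p k (h : ℕ → Bool → ℕ) →
  sumFlaggingLast h (p + suc k) ≡
  sum (applyUpTo (λ j → h j false) p) + sumFlaggingLast (λ j → h (p + j)) (suc k)
sumFlaggingLast-+ zero    k h = refl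
sumFlaggingLast-+ (suc p) k h = begin
  h 0 (0 ≡ᵇ p + suc k) + sumFlaggingLast (h ∘ suc) (p + suc k)
    ≡⟨ cong₂ _+_ (cong (h 0 ∘ (0 ≡ᵇ_)) (+-suc p k)) (sumFlaggingLast-+ p k (h ∘ suc)) ⟩
  h 0 false + (sum (applyUpTo (λ j → h (suc j) false) p) + sumFlaggingLast (λ j → h (suc p + j)) (suc k))
    ≡⟨ sym (+-assoc (h 0 false) _ _) ⟩
  sum (applyUpTo (λ j → h j false) (suc p)) + sumFlaggingLast (λ j → h (suc p + j)) (suc k)
    ∎
  where open ≡-Reasoning

sumFlaggingLast-periodic : ∀ p (h : ℕ → Bool → ℕ) → (∀ j b → h (p + j) b ≡ h j b) → ∀ q r →
  sumFlaggingLast h (q * p + suc r) ≡ q * sum (applyUpTo (λ j → h j false) p) + sumFlaggingLast h (suc r)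
sumFlaggingLast-periodic p h periodic zero    r = refl
sumFlaggingLast-periodic p h periodic (suc q) r = begin
  sumFlaggingLast h ((p + q * p) + suc r)
    ≡⟨ cong (sumFlaggingLast h) (trans (+-assoc p (q * p) (suc r)) (cong (p +_) (+-suc (q * p) r))) ⟩
  sumFlaggingLast h (p + suc (q * p + r))
    ≡⟨ sumFlaggingLast-+ p (q * p + r) h ⟩
  P + sumFlaggingLast (λ j → h (p + j)) (suc (q * p + r))
    ≡⟨ cong (P +_) (sum-applyUpTo-cong (λ j → periodic j (suc j ≡ᵇ suc (q * p + r))) (suc (q * p + r))) ⟩
  P + sumFlaggingLast h (suc (q * p + r))
    ≡⟨ cong (λ k → P + sumFlaggingLast h k) (sym (+-suc (q * p) r)) ⟩
  P + sumFlaggingLast h (q * p + suc r)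
    ≡⟨ cong (P +_) (sumFlaggingLast-periodic p h periodic q r) ⟩
  P + (q * P + sumFlaggingLast h (suc r))
    ≡⟨ sym (+-assoc P (q * P) _) ⟩
  suc q * P + sumFlaggingLast h (suc r)
    ∎
  where
  open ≡-Reasoning
  P = sum (applyUpTo (λ j → h j false) p)

-- Unlike `_mod 4`, this reduces on `suc`s: `mod4 (4 + k)` is definitionally `mod4 k`.
mod4 : ℕ → Fin 4
mod4 0 = 0F
mod4 1 = 1F
mod4 2 = 2F
mod4 3 = 3F
mod4 (suc (suc (suc (suc k)))) = mod4 k

next4 : Fin 4 → Fin 4
next4 0F = 1F
next4 1F = 2F
next4 2F = 3F
next4 3F = 0F

prev4 : Fin 4 → Fin 4
prev4 0F = 3F
prev4 1F = 0F
prev4 2F = 1F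
prev4 3F = 2F

prev4-next4 : ∀ t → prev4 (next4 t) ≡ t
prev4-next4 0F = refl
prev4-next4 1F = refl
prev4-next4 2F = refl
prev4-next4 3F = refl

next4-injective : ∀ {s t} → next4 s ≡ next4 t → s ≡ t
next4-injective {s} {t} e = trans (sym (prev4-next4 s)) (trans (cong prev4 e) (prev4-next4 t))

mod4-suc : ∀ k → mod4 (suc k) ≡ next4 (mod4 k)
mod4-suc 0 = refl
mod4-suc 1 = refl
mod4-suc 2 = refl
mod4-suc 3 = refl
mod4-suc (suc (suc (suc (suc k)))) = mod4-suc k

mod4-pred : ∀ k t → mod4 (suc k) ≡ next4 t → mod4 k ≡ t
mod4-pred k t e = next4-injective (trans (sym (mod4-suc k)) e)

isEven : Fin 4 → Bool
isEven 0F = true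
isEven 1F = false
isEven 2F = true
isEven 3F = false

isEven-next4 : ∀ t → isEven (next4 t) ≡ not (isEven t)
isEven-next4 0F = refl
isEven-next4 1F = refl
isEven-next4 2F = refl
isEven-next4 3F = refl

isEven-mod4-suc : ∀ k → isEven (mod4 (suc k)) ≡ not (isEven (mod4 k))
isEven-mod4-suc k = trans (cong isEven (mod4-suc k)) (isEven-next4 (mod4 k))

-- Row phase × column phase, then the flags "last column" and "last row".  Away from
-- the last row and column the tile is
--     0 2 0 1
--     1 0 1 0
--     0 1 0 2
--     1 0 1 0
-- of weight 10; the last column and the last row are raised where a zero would
-- lose its defending 2 or meet the zeros of column 0.
tile : Fin 4 → Fin 4 → Bool → Bool → Fin 3
tile 0F 0F false _     = 0F
tile 0F 0F true  _     = 1F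
tile 0F 1F _     _     = 2F
tile 0F 2F false _     = 0F
tile 0F 2F true  _     = 1F
tile 0F 3F _     _     = 1F
tile 1F 0F _     _     = 1F
tile 1F 1F _     _     = 0F
tile 1F 2F _     _     = 1F
tile 1F 3F _     false = 0F
tile 1F 3F _     true  = 1F
tile 2F 0F false _     = 0F
tile 2F 0F true  _     = 2F
tile 2F 1F false _     = 1F
tile 2F 1F true  _     = 2F
tile 2F 2F false _     = 0F
tile 2F 2F true  _     = 2F
tile 2F 3F _     _     = 2F
tile 3F 0F _     _     = 1F
tile 3F 1F _     false = 0F
tile 3F 1F _     true  = 1F
tile 3F 2F _     _     = 1F
tile 3F 3F _     _     = 0F

data TileZero : Fin 4 → Fin 4 → Bool → Bool → Set where
  z00 : ∀ {lr} → TileZero 0F 0F false lr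
  z02 : ∀ {lr} → TileZero 0F 2F false lr
  z20 : ∀ {lr} → TileZero 2F 0F false lr
  z22 : ∀ {lr} → TileZero 2F 2F false lr
  z11 : ∀ {lc lr} → TileZero 1F 1F lc lr
  z33 : ∀ {lc lr} → TileZero 3F 3F lc lr
  z13 : ∀ {lc} → TileZero 1F 3F lc false
  z31 : ∀ {lc} → TileZero 3F 1F lc false

tile-zero : ∀ t c lc lr → tile t c lc lr ≡ 0F → TileZero t c lc lr
tile-zero 0F 0F false _     _ = z00
tile-zero 0F 0F true  _     ()
tile-zero 0F 1F _     _     ()
tile-zero 0F 2F false _     _ = z02
tile-zero 0F 2F true  _     ()
tile-zero 0F 3F _     _     ()
tile-zero 1F 0F _     _     ()
tile-zero 1F 1F _     _     _ = z11
tile-zero 1F 2F _     _     ()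
tile-zero 1F 3F _     false _ = z13
tile-zero 1F 3F _     true  ()
tile-zero 2F 0F false _     _ = z20
tile-zero 2F 0F true  _     ()
tile-zero 2F 1F false _     ()
tile-zero 2F 1F true  _     ()
tile-zero 2F 2F false _     _ = z22
tile-zero 2F 2F true  _     ()
tile-zero 2F 3F _     _     ()
tile-zero 3F 0F _     _     ()
tile-zero 3F 1F _     false _ = z31
tile-zero 3F 1F _     true  ()
tile-zero 3F 2F _     _     ()
tile-zero 3F 3F _     _     _ = z33

tileZero-parity : ∀ {t c lc lr} → TileZero t c lc lr → isEven t ≡ isEven c
tileZero-parity z00 = refl
tileZero-parity z02 = refl
tileZero-parity z20 = refl
tileZero-parity z22 = refl
tileZero-parity z11 = refl
tileZero-parity z33 = refl
tileZero-parity z13 = refl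
tileZero-parity z31 = refl

tileZero-lastColumn : ∀ {t c lr} → TileZero t c true lr → isEven t ≡ false
tileZero-lastColumn z11 = refl
tileZero-lastColumn z33 = refl
tileZero-lastColumn z13 = refl
tileZero-lastColumn z31 = refl

tile-2F-lastColumn : ∀ c lr → tile 2F c true lr ≡ 2F
tile-2F-lastColumn 0F _ = refl
tile-2F-lastColumn 1F _ = refl
tile-2F-lastColumn 2F _ = refl
tile-2F-lastColumn 3F _ = refl

tiling : (o n m : ℕ) → ℕ × ℕ → Fin 3
tiling o n m (i , j) = tile (mod4 (i + o)) (mod4 j) (suc j ≡ᵇ m) (suc i ≡ᵇ n)

is-last : ∀ {j m} → suc j ≡ m → (suc j ≡ᵇ m) ≡ true
is-last {j} {m} e = Equivalence.to T-≡ (≡⇒≡ᵇ (suc j) m e)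

next-inside : ∀ {j m} → j < m → (suc j ≡ᵇ m) ≡ false → suc j < m
next-inside j<m not-last = ≤∧≢⇒< j<m λ e → contradiction (trans (sym (is-last e)) not-last) λ ()

module _ {o n m : ℕ} .{{_ : NonZero m}} where

  tiling-zero : ∀ {i j} → tiling o n m (i , j) ≡ 0F →
    TileZero (mod4 (i + o)) (mod4 j) (suc j ≡ᵇ m) (suc i ≡ᵇ n)
  tiling-zero = tile-zero _ _ _ _

  tiling-no-zero-step : ∀ {p q} → Step m p q → tiling o n m p ≡ 0F → tiling o n m q ≡ 0F → ⊥
  tiling-no-zero-step {i , j} right zp zq =
    not-¬ (tileZero-parity (tiling-zero zp))
          (trans (tileZero-parity (tiling-zero zq)) (isEven-mod4-suc j))
  tiling-no-zero-step {i , j} down zp zq =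
    not-¬ (sym (tileZero-parity (tiling-zero zp)))
          (sym (trans (sym (isEven-mod4-suc (i + o))) (tileZero-parity (tiling-zero zq))))
  tiling-no-zero-step {i , j} (wrap 1+j≡m) zp zq =
    contradiction (trans (sym odd) (tileZero-parity (tiling-zero zq))) λ ()
    where
    odd : isEven (mod4 (i + o)) ≡ false
    odd = tileZero-lastColumn
      (subst (λ b → TileZero (mod4 (i + o)) (mod4 j) b (suc i ≡ᵇ n)) (is-last 1+j≡m) (tiling-zero zp))

  tiling-at : ∀ {i j t c} → mod4 (i + o) ≡ t → mod4 j ≡ c → (∀ lc lr → tile t c lc lr ≡ 2F) →
    tiling o n m (i , j) ≡ 2F
  tiling-at row col two rewrite row | col = two _ _

  tiling-lastColumn : ∀ {i j} → mod4 (i + o) ≡ 2F → suc j ≡ m → tiling o n m (i , j) ≡ 2F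
  tiling-lastColumn {j = j} row 1+j≡m rewrite row | is-last 1+j≡m = tile-2F-lastColumn (mod4 j) _

  -- The first row must have even phase: rows of odd phase are defended from above.
  module _ (o-even : isEven (mod4 o) ≡ true) where

    defend : ∀ {i j t c lc lr} → InGrid n m (i , j) →
      mod4 (i + o) ≡ t → mod4 j ≡ c → (suc j ≡ᵇ m) ≡ lc → (suc i ≡ᵇ n) ≡ lr →
      TileZero t c lc lr → Defended n m (tiling o n m) (i , j)
    defend {j = j} (i<n , j<m) row col lastCol _ z00 =
      _ , (i<n , next-inside j<m lastCol) , inj₁ right ,
      tiling-at row (trans (mod4-suc j) (cong next4 col)) λ _ _ → refl
    defend {j = j} (i<n , j<m) row col lastCol _ z22 =
      _ , (i<n , next-inside j<m lastCol) , inj₁ right ,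
      tiling-at row (trans (mod4-suc j) (cong next4 col)) λ _ _ → refl
    defend {j = zero}  _           _   ()  _ _ z02
    defend {j = suc j} (i<n , j<m) row col _ _ z02 =
      _ , (i<n , <⇒≤ j<m) , inj₂ right , tiling-at row (mod4-pred j 1F col) λ _ _ → refl
    defend {j = zero}  (i<n , _)   row _   _ _ z20 =
      _ , (i<n , ≤-reflexive (suc-pred m)) , inj₂ (wrap (suc-pred m)) ,
      tiling-lastColumn row (suc-pred m)
    defend {j = suc j} (i<n , j<m) row col _ _ z20 =
      _ , (i<n , <⇒≤ j<m) , inj₂ right , tiling-at row (mod4-pred j 3F col) λ _ _ → refl
    defend {i = i} (i<n , j<m) row col _ lastRow z13 =
      _ , (next-inside i<n lastRow , j<m) , inj₁ down ,
      tiling-at (trans (mod4-suc (i + o)) (cong next4 row)) col λ _ _ → refl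
    defend {i = i} (i<n , j<m) row col _ lastRow z31 =
      _ , (next-inside i<n lastRow , j<m) , inj₁ down ,
      tiling-at (trans (mod4-suc (i + o)) (cong next4 row)) col λ _ _ → refl
    defend {i = zero}  _           row _   _ _ z11 = contradiction (trans (sym o-even) (cong isEven row)) λ ()
    defend {i = suc i} (i<n , j<m) row col _ _ z11 =
      _ , (<⇒≤ i<n , j<m) , inj₂ down , tiling-at (mod4-pred (i + o) 0F row) col λ _ _ → refl
    defend {i = zero}  _           row _   _ _ z33 = contradiction (trans (sym o-even) (cong isEven row)) λ ()
    defend {i = suc i} (i<n , j<m) row col _ _ z33 =
      _ , (<⇒≤ i<n , j<m) , inj₂ down , tiling-at (mod4-pred (i + o) 2F row) col λ _ _ → refl

    tiling-isOIRDF : IsOIRDF n m (tiling o n m ∘ coords)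
    tiling-isOIRDF = grid-isOIRDF (tiling o n m) tiling-no-zero-step
      λ inGrid z → defend inGrid refl refl refl refl (tiling-zero z)

rowWeight : (o m i : ℕ) → Bool → ℕ
rowWeight o m i lastRow = sumFlaggingLast (λ j lastCol → toℕ (tile (mod4 (i + o)) (mod4 j) lastCol lastRow)) m

tilingWeight : (o n m : ℕ) → ℕ
tilingWeight o n m = sumFlaggingLast (rowWeight o m) n

weight-tiling : ∀ o {n m} → weight n m (tiling o n m ∘ coords) ≡ tilingWeight o n m
weight-tiling o {n} {m} = weight-grid {n} {m} (tiling o n m)

fourColumnsWeight : (o i : ℕ) → Bool → ℕ
fourColumnsWeight o i lastRow = sum (applyUpTo (λ j → toℕ (tile (mod4 (i + o)) (mod4 j) false lastRow)) 4)

fourRowsWeight : (o m : ℕ) → ℕ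
fourRowsWeight o m = sum (applyUpTo (λ i → rowWeight o m i false) 4)

tileWeight : ℕ → ℕ
tileWeight o = sum (applyUpTo (λ i → fourColumnsWeight o i false) 4)

rowWeight-periodic : ∀ o q r i lastRow →
  rowWeight o (q * 4 + suc r) i lastRow ≡ q * fourColumnsWeight o i lastRow + rowWeight o (suc r) i lastRow
rowWeight-periodic o q r i lastRow =
  sumFlaggingLast-periodic 4 (λ j lastCol → toℕ (tile (mod4 (i + o)) (mod4 j) lastCol lastRow))
    (λ _ _ → refl) q r

tilingWeight-periodic : ∀ o q r k s →
  tilingWeight o (k * 4 + suc s) (q * 4 + suc r) ≡
  q * (k * tileWeight o + sumFlaggingLast (fourColumnsWeight o) (suc s)) +
  (k * fourRowsWeight o (suc r) + tilingWeight o (suc s) (suc r))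
tilingWeight-periodic o q r k s = begin
  tilingWeight o n (q * 4 + suc r)
    ≡⟨ sum-applyUpTo-cong (λ i → rowWeight-periodic o q r i (suc i ≡ᵇ n)) n ⟩
  sumFlaggingLast (λ i lastRow → q * fourColumnsWeight o i lastRow + rowWeight o (suc r) i lastRow) n
    ≡⟨ sum-applyUpTo-linear q _ _ n ⟩
  q * sumFlaggingLast (fourColumnsWeight o) n + sumFlaggingLast (rowWeight o (suc r)) n
    ≡⟨ cong₂ (λ x y → q * x + y) (sumFlaggingLast-periodic 4 (fourColumnsWeight o) (λ _ _ → refl) k s)
                                 (sumFlaggingLast-periodic 4 (rowWeight o (suc r)) (λ _ _ → refl) k s) ⟩
  q * (k * tileWeight o + sumFlaggingLast (fourColumnsWeight o) (suc s)) +
  (k * fourRowsWeight o (suc r) + tilingWeight o (suc s) (suc r))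
    ∎
  where
  open ≡-Reasoning
  n = k * 4 + suc s

bilinear-bound : ∀ q k {r s F B C D} →
  F ≤ 10 → 8 * B ≤ 20 * s + 8 → 8 * C ≤ 20 * r + 20 → 8 * D ≤ 5 * r * s + 5 * s + 2 * r →
  8 * (q * (k * F + B) + (k * C + D)) ≤
  5 * (q * 4 + r) * (k * 4 + s) + 5 * (k * 4 + s) + 2 * (q * 4 + r)
bilinear-bound q k {r} {s} {F} {B} {C} {D} F≤ B≤ C≤ D≤ = begin
  8 * (q * (k * F + B) + (k * C + D))
    ≡⟨ expand q k F B C D ⟩
  q * k * (8 * F) + q * (8 * B) + k * (8 * C) + 8 * D
    ≤⟨ +-mono-≤ (+-mono-≤ (+-mono-≤ (*-monoʳ-≤ (q * k) (*-monoʳ-≤ 8 F≤)) (*-monoʳ-≤ q B≤))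
                          (*-monoʳ-≤ k C≤))
                D≤ ⟩
  q * k * 80 + q * (20 * s + 8) + k * (20 * r + 20) + (5 * r * s + 5 * s + 2 * r)
    ≡⟨ collect q k r s ⟩
  5 * (q * 4 + r) * (k * 4 + s) + 5 * (k * 4 + s) + 2 * (q * 4 + r)
    ∎
  where
  open ≤-Reasoning
  expand : ∀ q k F B C D →
    8 * (q * (k * F + B) + (k * C + D)) ≡ q * k * (8 * F) + q * (8 * B) + k * (8 * C) + 8 * D
  expand = solve-∀
  collect : ∀ q k r s →
    q * k * 80 + q * (20 * s + 8) + k * (20 * r + 20) + (5 * r * s + 5 * s + 2 * r) ≡
    5 * (q * 4 + r) * (k * 4 + s) + 5 * (k * 4 + s) + 2 * (q * 4 + r)
  collect = solve-∀

ResidueBounds : (o r s : ℕ) → Set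
ResidueBounds o r s =
  T (tileWeight o ≤ᵇ 10) ×
  T (8 * sumFlaggingLast (fourColumnsWeight o) s ≤ᵇ 20 * s + 8) ×
  T (8 * fourRowsWeight o r ≤ᵇ 20 * r + 20) ×
  T (8 * tilingWeight o s r ≤ᵇ 5 * r * s + 5 * s + 2 * r)

tilingWeight-bound : ∀ o {n m q r k s} →
  m ≡ q * 4 + suc r → n ≡ k * 4 + suc s → ResidueBounds o (suc r) (suc s) →
  8 * tilingWeight o n m ≤ 5 * m * n + 5 * n + 2 * m
tilingWeight-bound o {q = q} {r} {k} {s} refl refl (F≤ , B≤ , C≤ , D≤) =
  ≤-trans (≤-reflexive (cong (8 *_) (tilingWeight-periodic o q r k s)))
    (bilinear-bound q k (≤ᵇ⇒≤ _ _ F≤) (≤ᵇ⇒≤ _ _ B≤) (≤ᵇ⇒≤ _ _ C≤) (≤ᵇ⇒≤ _ _ D≤))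

-- Remainders are taken in 4‥7 rather than 0‥3 because the corner term (q = k = 0)
-- has to satisfy the bound on its own.
data Remainder : ℕ → Set where
  four  : Remainder 4
  five  : Remainder 5
  six   : Remainder 6
  seven : Remainder 7

quotRem4 : ∀ {m} → 4 ≤ m → ∃₂ λ q r → Remainder (suc r) × m ≡ q * 4 + suc r
quotRem4 {4} _ = 0 , 3 , four  , refl
quotRem4 {5} _ = 0 , 4 , five  , refl
quotRem4 {6} _ = 0 , 5 , six   , refl
quotRem4 {7} _ = 0 , 6 , seven , refl
quotRem4 {1} (s≤s ())
quotRem4 {2} (s≤s (s≤s ()))
quotRem4 {3} (s≤s (s≤s (s≤s ())))
quotRem4 {suc (suc (suc (suc m@(suc (suc (suc (suc _)))))))} _
  with q , r , ρ , m≡ ← quotRem4 {m} (s≤s (s≤s (s≤s (s≤s z≤n))))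
  = suc q , r , ρ , cong (4 +_) m≡

-- With o = 0 throughout, the bound fails for n ≡ 0 (mod 4), e.g. for n = 4, m = 7.
startOffset : ∀ {s} → Remainder s → ℕ
startOffset four = 2
startOffset _    = 0

startOffset-even : ∀ {s} (ρ : Remainder s) → isEven (mod4 (startOffset ρ)) ≡ true
startOffset-even four  = refl
startOffset-even five  = refl
startOffset-even six   = refl
startOffset-even seven = refl

residue-bounds : ∀ {r s} (ρm : Remainder r) (ρn : Remainder s) → ResidueBounds (startOffset ρn) r s
residue-bounds four  four  = _
residue-bounds four  five  = _
residue-bounds four  six   = _
residue-bounds four  seven = _
residue-bounds five  four  = _
residue-bounds five  five  = _
residue-bounds five  six   = _
residue-bounds five  seven = _
residue-bounds six   four  = _
residue-bounds six   five  = _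
residue-bounds six   six   = _
residue-bounds six   seven = _
residue-bounds seven four  = _
residue-bounds seven five  = _
residue-bounds seven six   = _
residue-bounds seven seven = _

theorem5 : (m n : ℕ) → 4 ≤ m → 4 ≤ n → .{{_ : NonZero m}} →
    γoiR≤ n m (5 * m * n + 5 * n + 2 * m) 8
theorem5 m n 4≤m 4≤n with q , r , ρm , m≡ ← quotRem4 4≤m | k , s , ρn , n≡ ← quotRem4 4≤n =
  tiling o n m ∘ coords , tiling-isOIRDF (startOffset-even ρn) , weight-bound
  where
  o = startOffset ρn
  weight-bound : 8 * weight n m (tiling o n m ∘ coords) ≤ 5 * m * n + 5 * n + 2 * m
  weight-bound = ≤-trans (≤-reflexive (cong (8 *_) (weight-tiling o {n} {m})))
                         (tilingWeight-bound o {q = q} {k = k} m≡ n≡ (residue-bounds ρm ρn))
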